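{- In the setting below, let $T_{\min}$ be an addition tree over $X$ of minimum cost. If a node $z$ of $T_{\min}$ is of the form $(1/3+\lambda)H$, then $z$ is a leaf.
   Context: Let $m,K$ be positive integers and $b_1,\ldots,b_{3m}$ positive integers with $K/4<b_i<K/2$ and $\sum_i b_i=mK$. Set $W=100(5m)^2K$, $a_i=b_i+W$, $L=3W+K$, $\varepsilon=1/(400(5m)^2)$, $h=\lfloor4\varepsilon L\rfloor$, $H=L+h$. Let $X$ be the multiset consisting of $a_1,\ldots,a_{3m}$, $m$ copies of $-H$ and $m$ copies of $h$. An addition tree over $X$ is a rooted full binary tree whose leaves are in bijection with the elements of $X$ (with multiplicity), labelled by them; a node's value is the sum of the labels of leaves in its subtree, and nodes are identified with their values. The cost is the sum of absolute values of internal nodes. Every node value $v$ of such a tree satisfies $|v/H-N/3|\le 1/(500m)$ for a unique integer $N$; we then say $v$ is of the form $(N/3+\lambda)H$ (with $|\lambda|\le1/(500m)$). -}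

module Defs where

open import Data.Nat as ℕ using (ℕ; zero; suc; _^_)
open import Data.Nat.DivMod using (_/_)
open import Data.Integer as ℤ using (ℤ; +_; -_; ∣_∣)
open import Data.Fin using (Fin)
open import Data.List using (List; []; _∷_; _++_; map; replicate; sum)
open import Data.List.Relation.Binary.Permutation.Propositional using (_↭_)
open import Data.Product using (∃)
open import Relation.Binary.PropositionalEquality using (_≡_)
open import Data.Vec.Functional using (toList)

data Tree : Set where
  leaf : ℤ → Tree
  node : Tree → Tree → Tree

-- multiset of leaf labels (as a list; compared up to permutation)
leaves : Tree → List ℤ
leaves (leaf x)   = x ∷ []
leaves (node l r) = leaves l ++ leaves r

value : Tree → ℤ
value (leaf x)   = x
value (node l r) = value l ℤ.+ value r

cost : Tree → ℕ
cost (leaf x)   = 0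
cost (node l r) = ∣ value l ℤ.+ value r ∣ ℕ.+ (cost l ℕ.+ cost r)

IsTreeOver : List ℤ → Tree → Set
IsTreeOver X T = leaves T ↭ X

data _⊑_ : Tree → Tree → Set where
  here  : ∀ {t} → t ⊑ t
  left  : ∀ {s l r} → s ⊑ l → s ⊑ node l r
  right : ∀ {s l r} → s ⊑ r → s ⊑ node l r

IsLeaf : Tree → Set
IsLeaf t = ∃ λ x → t ≡ leaf x

IsMinCost : List ℤ → Tree → Set
IsMinCost X T = IsTreeOver X T × (∀ T′ → IsTreeOver X T′ → cost T ℕ.≤ cost T′)
  where open import Data.Product using (_×_)

W : ℕ → ℕ → ℕ
W m K = 100 ℕ.* (5 ℕ.* m) ^ 2 ℕ.* K

L : ℕ → ℕ → ℕ
L m K = 3 ℕ.* W m K ℕ.+ K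

-- h = ⌊ 4 ε L ⌋ with ε = 1 / (400 (5m)^2), i.e. ⌊ 4L / (400 (5m)^2) ⌋  (m ≥ 1)
hh : ℕ → ℕ → ℕ
hh zero    K = 0
hh (suc k) K = (4 ℕ.* L (suc k) K) / (400 ℕ.* (5 ℕ.* suc k) ^ 2)

HH : ℕ → ℕ → ℕ
HH m K = L m K ℕ.+ hh m K

-- the multiset X: a_1..a_{3m}, m copies of -H, m copies of h
X : (m K : ℕ) → (Fin (3 ℕ.* m) → ℕ) → List ℤ
X m K b = map (λ bi → + (bi ℕ.+ W m K)) (toList b)
          ++ replicate m (- (+ HH m K))
          ++ replicate m (+ hh m K)

-- v is of the form (1/3 + λ) H with |λ| ≤ 1/(500m):
-- |v/H - 1/3| ≤ 1/(500 m)  ⇔  500 m |3v - H| ≤ 3H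
OfFormThird : (m K : ℕ) → ℤ → Set
OfFormThird m K v = 500 ℕ.* m ℕ.* ∣ (+ 3) ℤ.* v ℤ.- + HH m K ∣ ℕ.≤ 3 ℕ.* HH m K

{-# OPTIONS --safe #-}
-- Give each leaf the class -3 (for -H), 0 (for h) or 1 (for the a_i), and let thirds t be the
-- sum of the classes of the leaves of t; every node t then lies within a small error of
-- (thirds t / 3)·H.  Minimality of the tree yields two local facts.  Since the total value is 0,
-- a subtree x can be cut off and re-attached above the root at a cost of at most depth·|x|, so a
-- node with a child near 0 is itself near 0.  And in node (node u v) w the subtrees v and w may
-- be exchanged, so |u + v| ≤ |u + w|.  By induction, both children of a node with thirds > 0
-- have thirds > 0: a leaf has class at most 1, and a negative sibling w of node u v with
-- thirds u, thirds v > 0 would give |thirds u + thirds w| < |thirds u + thirds v| although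
-- |u + v| ≤ |u + w|.  A node near H/3 has thirds 1, which is not a sum of two positive
-- integers, so it is a leaf.
module Submission where

open import Defs
open import Data.Nat using (ℕ; _<_; _*_; _≤_)
open import Data.Fin using (Fin)
open import Data.Vec.Functional using (toList)
open import Data.Nat.ListAction using (sum)
open import Relation.Binary.PropositionalEquality using (_≡_)

open import Algebra.Bundles using (CommutativeMonoid)
import Algebra.Properties.CommutativeSemigroup as CommSemigroupProperties
open import Data.Nat as ℕ using (zero; suc; z≤n; s≤s; _^_)
open import Data.Nat.DivMod using (_/_; /-monoˡ-≤; m*n/n≡m)
import Data.Nat.Properties as ℕ
import Data.Nat.Tactic.RingSolver as ℕ-Solver
open import Data.Integer as ℤ using (ℤ; +_; -_; ∣_∣; 0ℤ; 1ℤ; _⊖_; +<+; -<+; +≤+; -≤+)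
import Data.Integer.Properties as ℤ
import Data.Integer.Tactic.RingSolver as ℤ-Solver
open import Data.List using (List; []; _∷_; _++_; foldr; length; map; replicate)
import Data.List.Properties as List
open import Data.List.Relation.Unary.All as All using (All; []; _∷_)
import Data.List.Relation.Unary.All.Properties as All
open import Data.List.Relation.Binary.Permutation.Propositional
  using (_↭_; ↭-refl; ↭-sym; ↭-trans; ↭⇒↭ₛ; module PermutationReasoning)
open import Data.List.Relation.Binary.Permutation.Propositional.Properties
  using (++⁺ˡ; ++⁺ʳ; ++-comm; ++-identityʳ; ++-commutativeMonoid; All-resp-↭; ↭-length)
open import Data.List.Relation.Binary.Permutation.Setoid.Properties using (foldr-commMonoid)
open import Data.Product using (_,_; proj₁; proj₂)
open import Data.Sum as Sum using (_⊎_; inj₁; inj₂)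
open import Data.Empty using (⊥; ⊥-elim)
open import Relation.Binary.Definitions using (tri<; tri≈; tri>)
open import Relation.Binary.PropositionalEquality
  using (_≢_; refl; sym; trans; cong; cong₂; subst; module ≡-Reasoning)
open import Relation.Nullary using (Dec; yes; no)
import Relation.Nullary.Decidable as Dec

private
  variable
    s s′ t p u v w x a b : Tree
    ys : List ℤ
    H e e′ : ℕ
    i j k N N′ δ : ℤ
    val val′ : ℤ

  module ℕ+ = CommSemigroupProperties ℕ.+-commutativeSemigroup
  module ℕ* = CommSemigroupProperties ℕ.*-commutativeSemigroup
  module ℤ+ = CommSemigroupProperties ℤ.+-commutativeSemigroup
  module ++ₚ = CommSemigroupProperties
    (CommutativeMonoid.commutativeSemigroup (++-commutativeMonoid {A = ℤ}))

-- Positions and surgery in addition trees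

size : Tree → ℕ
size (leaf _)   = 1
size (node l r) = size l ℕ.+ size r

size≥1 : ∀ t → 1 ≤ size t
size≥1 (leaf _)   = s≤s z≤n
size≥1 (node l r) = ℕ.≤-trans (size≥1 l) (ℕ.m≤m+n _ _)

size≡length-leaves : ∀ t → size t ≡ length (leaves t)
size≡length-leaves (leaf _)   = refl
size≡length-leaves (node l r) =
  trans (cong₂ ℕ._+_ (size≡length-leaves l) (size≡length-leaves r)) (sym (List.length-++ (leaves l)))

depth : s ⊑ t → ℕ
depth here      = 0
depth (left P)  = suc (depth P)
depth (right P) = suc (depth P)

depth+size≤size : (P : s ⊑ t) → depth P ℕ.+ size s ≤ size t
depth+size≤size here = ℕ.≤-refl
depth+size≤size {t = node l r} (left P) =
  ℕ.≤-trans (ℕ.≤-reflexive (ℕ.+-comm 1 _)) (ℕ.+-mono-≤ (depth+size≤size P) (size≥1 r))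
depth+size≤size {t = node l r} (right P) = ℕ.+-mono-≤ (size≥1 l) (depth+size≤size P)

⊑-trans : s ⊑ t → t ⊑ p → s ⊑ p
⊑-trans P here      = P
⊑-trans P (left Q)  = left (⊑-trans P Q)
⊑-trans P (right Q) = right (⊑-trans P Q)

All-⊑ : ∀ {Q : ℤ → Set} → s ⊑ t → All Q (leaves t) → All Q (leaves s)
All-⊑ here all = all
All-⊑ {t = node l r} (left P) all = All-⊑ P (All.++⁻ˡ (leaves l) all)
All-⊑ {t = node l r} (right P) all = All-⊑ P (All.++⁻ʳ (leaves l) all)

replace : s ⊑ t → Tree → Tree
replace here s′ = s′
replace (left {r = r} P) s′ = node (replace P s′) r
replace (right {l = l} P) s′ = node l (replace P s′)

leaves-replace : (P : s ⊑ t) → leaves s′ ++ ys ↭ leaves s → leaves (replace P s′) ++ ys ↭ leaves t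
leaves-replace here perm = perm
leaves-replace {t = node l r} {s′} {ys} (left P) perm = begin
  (leaves (replace P s′) ++ leaves r) ++ ys ↭⟨ ++ₚ.xy∙z≈xz∙y (leaves (replace P s′)) (leaves r) ys ⟩
  (leaves (replace P s′) ++ ys) ++ leaves r ↭⟨ ++⁺ʳ (leaves r) (leaves-replace P perm) ⟩
  leaves l ++ leaves r                      ∎
  where open PermutationReasoning
leaves-replace {t = node l r} {s′} {ys} (right P) perm = begin
  (leaves l ++ leaves (replace P s′)) ++ ys ≡⟨ List.++-assoc (leaves l) _ ys ⟩
  leaves l ++ (leaves (replace P s′) ++ ys) ↭⟨ ++⁺ˡ (leaves l) (leaves-replace P perm) ⟩
  leaves l ++ leaves r                      ∎
  where open PermutationReasoning

value-replace : (P : s ⊑ t) → value s′ ≡ value s ℤ.+ δ → value (replace P s′) ≡ value t ℤ.+ δ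
value-replace here eq = eq
value-replace {t = node l r} {δ = δ} (left P) eq =
  trans (cong (ℤ._+ value r) (value-replace P eq)) (ℤ+.xy∙z≈xz∙y (value l) δ (value r))
value-replace {t = node l r} {δ = δ} (right P) eq =
  trans (cong (λ v → value l ℤ.+ v) (value-replace P eq)) (sym (ℤ.+-assoc (value l) (value r) δ))

root-bound : (P : s ⊑ t) → value s′ ≡ value s ℤ.+ δ → ∣ value (replace P s′) ∣ ≤ ∣ value t ∣ ℕ.+ ∣ δ ∣
root-bound {t = t} {δ = δ} P eq =
  ℕ.≤-trans (ℕ.≤-reflexive (cong ∣_∣ (value-replace P eq))) (ℤ.∣i+j∣≤∣i∣+∣j∣ (value t) δ)

-- Each of the depth P ancestors of the replaced subtree changes its value by δ.
cost-replace : (P : s ⊑ t) → value s′ ≡ value s ℤ.+ δ →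
  cost (replace P s′) ℕ.+ cost s ≤ cost t ℕ.+ cost s′ ℕ.+ depth P * ∣ δ ∣
cost-replace {s = s} {s′ = s′} here eq =
  ℕ.≤-reflexive (trans (ℕ.+-comm (cost s′) (cost s)) (sym (ℕ.+-identityʳ _)))
cost-replace {s = s} {t = node l r} {s′ = s′} {δ = δ} (left P) eq = begin
  ∣ value rep ℤ.+ value r ∣ ℕ.+ (cost rep ℕ.+ cost r) ℕ.+ cost s
    ≡⟨ swap-cost ∣ value rep ℤ.+ value r ∣ (cost rep) (cost r) (cost s) ⟩
  ∣ value rep ℤ.+ value r ∣ ℕ.+ (cost rep ℕ.+ cost s) ℕ.+ cost r
    ≤⟨ ℕ.+-monoˡ-≤ (cost r) (ℕ.+-mono-≤ (root-bound {s′ = s′} (left {r = r} P) eq) (cost-replace {s′ = s′} P eq)) ⟩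
  ∣ value l ℤ.+ value r ∣ ℕ.+ ∣ δ ∣ ℕ.+ (cost l ℕ.+ cost s′ ℕ.+ depth P * ∣ δ ∣) ℕ.+ cost r
    ≡⟨ collect ∣ value l ℤ.+ value r ∣ ∣ δ ∣ (cost l) (cost s′) (depth P * ∣ δ ∣) (cost r) ⟩
  ∣ value l ℤ.+ value r ∣ ℕ.+ (cost l ℕ.+ cost r) ℕ.+ cost s′ ℕ.+ (∣ δ ∣ ℕ.+ depth P * ∣ δ ∣) ∎
  where
    open ℕ.≤-Reasoning
    rep : Tree
    rep = replace P s′
    swap-cost : ∀ a x o c → a ℕ.+ (x ℕ.+ o) ℕ.+ c ≡ a ℕ.+ (x ℕ.+ c) ℕ.+ o
    swap-cost = ℕ-Solver.solve-∀
    collect : ∀ a d x c f o → a ℕ.+ d ℕ.+ (x ℕ.+ c ℕ.+ f) ℕ.+ o ≡ a ℕ.+ (x ℕ.+ o) ℕ.+ c ℕ.+ (d ℕ.+ f)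
    collect = ℕ-Solver.solve-∀
cost-replace {s = s} {t = node l r} {s′ = s′} {δ = δ} (right P) eq = begin
  ∣ value l ℤ.+ value rep ∣ ℕ.+ (cost l ℕ.+ cost rep) ℕ.+ cost s
    ≡⟨ swap-cost ∣ value l ℤ.+ value rep ∣ (cost l) (cost rep) (cost s) ⟩
  ∣ value l ℤ.+ value rep ∣ ℕ.+ (cost rep ℕ.+ cost s) ℕ.+ cost l
    ≤⟨ ℕ.+-monoˡ-≤ (cost l) (ℕ.+-mono-≤ (root-bound {s′ = s′} (right {l = l} P) eq) (cost-replace {s′ = s′} P eq)) ⟩
  ∣ value l ℤ.+ value r ∣ ℕ.+ ∣ δ ∣ ℕ.+ (cost r ℕ.+ cost s′ ℕ.+ depth P * ∣ δ ∣) ℕ.+ cost l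
    ≡⟨ collect ∣ value l ℤ.+ value r ∣ ∣ δ ∣ (cost r) (cost s′) (depth P * ∣ δ ∣) (cost l) ⟩
  ∣ value l ℤ.+ value r ∣ ℕ.+ (cost l ℕ.+ cost r) ℕ.+ cost s′ ℕ.+ (∣ δ ∣ ℕ.+ depth P * ∣ δ ∣) ∎
  where
    open ℕ.≤-Reasoning
    rep : Tree
    rep = replace P s′
    swap-cost : ∀ a o x c → a ℕ.+ (o ℕ.+ x) ℕ.+ c ≡ a ℕ.+ (x ℕ.+ c) ℕ.+ o
    swap-cost = ℕ-Solver.solve-∀
    collect : ∀ a d x c f o → a ℕ.+ d ℕ.+ (x ℕ.+ c ℕ.+ f) ℕ.+ o ≡ a ℕ.+ (o ℕ.+ x) ℕ.+ c ℕ.+ (d ℕ.+ f)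
    collect = ℕ-Solver.solve-∀

record LocallyMinimal (s : Tree) : Set where
  constructor locallyMinimal
  field cost-minimal : ∀ s′ → value s′ ≡ value s → leaves s′ ↭ leaves s → cost s ≤ cost s′

locallyMinimal-swap : LocallyMinimal (node a b) → LocallyMinimal (node b a)
locallyMinimal-swap {a} {b} (locallyMinimal min) = locallyMinimal λ s′ eq perm →
  subst (_≤ cost s′) (cong₂ ℕ._+_ (cong ∣_∣ (ℤ.+-comm (value a) (value b))) (ℕ.+-comm (cost a) (cost b)))
    (min s′ (trans eq (ℤ.+-comm (value b) (value a))) (↭-trans perm (++-comm (leaves b) (leaves a))))

locallyMinimal-rotate : LocallyMinimal (node (node u v) w) → ∣ value u ℤ.+ value v ∣ ≤ ∣ value u ℤ.+ value w ∣
locallyMinimal-rotate {u} {v} {w} (locallyMinimal min) =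
  ℕ.+-cancelʳ-≤ others _ _ (ℕ.+-cancelˡ-≤ root _ _ (begin
    root ℕ.+ (∣uv∣ ℕ.+ others)          ≡⟨ cong (root ℕ.+_) (sym (ℕ.+-assoc ∣uv∣ _ (cost w))) ⟩
    cost (node (node u v) w)           ≤⟨ min (node (node u w) v) same-value same-leaves ⟩
    cost (node (node u w) v)           ≡⟨ cong₂ ℕ._+_ (cong ∣_∣ same-value) regroup ⟩
    root ℕ.+ (∣uw∣ ℕ.+ others)          ∎))
  where
    open ℕ.≤-Reasoning
    root ∣uv∣ ∣uw∣ others : ℕ
    root   = ∣ value u ℤ.+ value v ℤ.+ value w ∣
    ∣uv∣   = ∣ value u ℤ.+ value v ∣
    ∣uw∣   = ∣ value u ℤ.+ value w ∣
    others = cost u ℕ.+ cost v ℕ.+ cost w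
    same-value : value u ℤ.+ value w ℤ.+ value v ≡ value u ℤ.+ value v ℤ.+ value w
    same-value = ℤ+.xy∙z≈xz∙y (value u) (value w) (value v)
    same-leaves : (leaves u ++ leaves w) ++ leaves v ↭ (leaves u ++ leaves v) ++ leaves w
    same-leaves = ++ₚ.xy∙z≈xz∙y (leaves u) (leaves w) (leaves v)
    regroup : ∣uw∣ ℕ.+ (cost u ℕ.+ cost w) ℕ.+ cost v ≡ ∣uw∣ ℕ.+ others
    regroup = trans (ℕ.+-assoc ∣uw∣ _ (cost v)) (cong (∣uw∣ ℕ.+_) (ℕ+.xy∙z≈xz∙y (cost u) (cost w) (cost v)))

module _ {X : List ℤ} {T : Tree} (T-min : IsMinCost X T) where

  minCost⇒locallyMinimal : s ⊑ T → LocallyMinimal s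
  minCost⇒locallyMinimal {s} P = locallyMinimal minimal
    where
      open ℕ.≤-Reasoning
      minimal : ∀ s′ → value s′ ≡ value s → leaves s′ ↭ leaves s → cost s ≤ cost s′
      minimal s′ eq perm = ℕ.+-cancelˡ-≤ (cost T) _ _ (begin
        cost T ℕ.+ cost s                  ≤⟨ ℕ.+-monoˡ-≤ (cost s) (proj₂ T-min (replace P s′) over-X) ⟩
        cost (replace P s′) ℕ.+ cost s     ≤⟨ cost-replace P (trans eq (sym (ℤ.+-identityʳ (value s)))) ⟩
        cost T ℕ.+ cost s′ ℕ.+ depth P * 0 ≡⟨ cong (cost T ℕ.+ cost s′ ℕ.+_) (ℕ.*-zeroʳ (depth P)) ⟩
        cost T ℕ.+ cost s′ ℕ.+ 0           ≡⟨ ℕ.+-identityʳ _ ⟩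
        cost T ℕ.+ cost s′                 ∎)
        where
          over-X : leaves (replace P s′) ↭ X
          over-X = ↭-trans (↭-sym (++-identityʳ _))
            (↭-trans (leaves-replace P (↭-trans (++-identityʳ _) perm)) (proj₁ T-min))

  -- Cutting x off its parent p and re-attaching it above the root gives another tree over X.
  minCost-regraft : (P : p ⊑ T) → value p ≡ value x ℤ.+ value s → leaves s ++ leaves x ↭ leaves p →
    cost p ≡ ∣ value p ∣ ℕ.+ (cost x ℕ.+ cost s) → ∣ value p ∣ ≤ ∣ value T ∣ ℕ.+ depth P * ∣ value x ∣
  minCost-regraft {p} {x} {s} P value-p perm cost-p =
    ℕ.+-cancelˡ-≤ (cost rest ℕ.+ cost x ℕ.+ cost s) _ _ (begin
      cost rest ℕ.+ cost x ℕ.+ cost s ℕ.+ ∣ value p ∣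
        ≡⟨ trans (regroup (cost rest) (cost x) (cost s) _) (cong (cost rest ℕ.+_) (sym cost-p)) ⟩
      cost rest ℕ.+ cost p
        ≤⟨ cost-replace P value-s ⟩
      cost T ℕ.+ cost s ℕ.+ depth P * ∣ - value x ∣
        ≤⟨ ℕ.+-monoˡ-≤ _ (ℕ.+-monoˡ-≤ (cost s) (proj₂ T-min (node rest x) over-X)) ⟩
      ∣ value rest ℤ.+ value x ∣ ℕ.+ (cost rest ℕ.+ cost x) ℕ.+ cost s ℕ.+ depth P * ∣ - value x ∣
        ≡⟨ cong₂ (λ r d → r ℕ.+ (cost rest ℕ.+ cost x) ℕ.+ cost s ℕ.+ depth P * d)
             (cong ∣_∣ value-root) (ℤ.∣-i∣≡∣i∣ (value x)) ⟩
      ∣ value T ∣ ℕ.+ (cost rest ℕ.+ cost x) ℕ.+ cost s ℕ.+ depth P * ∣ value x ∣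
        ≡⟨ collect ∣ value T ∣ (cost rest) (cost x) (cost s) _ ⟩
      cost rest ℕ.+ cost x ℕ.+ cost s ℕ.+ (∣ value T ∣ ℕ.+ depth P * ∣ value x ∣) ∎)
    where
      open ℕ.≤-Reasoning
      rest : Tree
      rest = replace P s
      value-s : value s ≡ value p ℤ.+ - value x
      value-s = trans (cancel (value x) (value s)) (cong (λ z → z ℤ.+ - value x) (sym value-p))
        where
          cancel : ∀ a b → b ≡ a ℤ.+ b ℤ.+ - a
          cancel = ℤ-Solver.solve-∀
      value-root : value rest ℤ.+ value x ≡ value T
      value-root = trans (cong (λ z → z ℤ.+ value x) (value-replace P value-s)) (cancel (value T) (value x))
        where
          cancel : ∀ a b → a ℤ.+ - b ℤ.+ b ≡ a
          cancel = ℤ-Solver.solve-∀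
      over-X : leaves rest ++ leaves x ↭ X
      over-X = ↭-trans (leaves-replace P perm) (proj₁ T-min)
      regroup : ∀ r a b c → r ℕ.+ a ℕ.+ b ℕ.+ c ≡ r ℕ.+ (c ℕ.+ (a ℕ.+ b))
      regroup = ℕ-Solver.solve-∀
      collect : ∀ c r a b d → c ℕ.+ (r ℕ.+ a) ℕ.+ b ℕ.+ d ≡ r ℕ.+ a ℕ.+ b ℕ.+ (c ℕ.+ d)
      collect = ℕ-Solver.solve-∀

total : List ℤ → ℤ
total = foldr ℤ._+_ 0ℤ

total-++ : ∀ xs ys → total (xs ++ ys) ≡ total xs ℤ.+ total ys
total-++ []       ys = sym (ℤ.+-identityˡ (total ys))
total-++ (x ∷ xs) ys = trans (cong (λ z → x ℤ.+ z) (total-++ xs ys)) (sym (ℤ.+-assoc x (total xs) (total ys)))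

total-↭ : ∀ {xs ys} → xs ↭ ys → total xs ≡ total ys
total-↭ perm = foldr-commMonoid ℤ-+-0.setoid ℤ-+-0.isCommutativeMonoid (↭⇒↭ₛ perm)
  where module ℤ-+-0 = CommutativeMonoid ℤ.+-0-commutativeMonoid

value≡total-leaves : ∀ t → value t ≡ total (leaves t)
value≡total-leaves (leaf x)   = sym (ℤ.+-identityʳ x)
value≡total-leaves (node l r) =
  trans (cong₂ ℤ._+_ (value≡total-leaves l) (value≡total-leaves r)) (sym (total-++ (leaves l) (leaves r)))

value-over : ∀ {X} → IsTreeOver X t → value t ≡ total X
value-over {t} over = trans (value≡total-leaves t) (total-↭ over)

size-over : ∀ {X} → IsTreeOver X t → size t ≡ length X
size-over {t} over = trans (size≡length-leaves t) (↭-length over)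

total-replicate : ∀ n x → total (replicate n x) ≡ + n ℤ.* x
total-replicate zero    x = sym (ℤ.*-zeroˡ x)
total-replicate (suc n) x = trans (cong (λ z → x ℤ.+ z) (total-replicate n x)) (sym (ℤ.suc-* (+ n) x))

total-shift : ∀ c ns → total (map (λ n → + (n ℕ.+ c)) ns) ≡ + (sum ns ℕ.+ length ns * c)
total-shift c []       = refl
total-shift c (n ∷ ns) = trans (cong (λ z → + (n ℕ.+ c) ℤ.+ z) (total-shift c ns))
  (cong +_ (regroup n c (sum ns) (length ns)))
  where
    regroup : ∀ n c s l → n ℕ.+ c ℕ.+ (s ℕ.+ l * c) ≡ n ℕ.+ s ℕ.+ (c ℕ.+ l * c)
    regroup = ℕ-Solver.solve-∀

-- Values close to a multiple of H/3

-- 3v is within e of N·H, i.e. v is within e/3 of (N/3)·H.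
record Near (H e : ℕ) (v N : ℤ) : Set where
  constructor near
  field distance≤ : ∣ + 3 ℤ.* v ℤ.- N ℤ.* + H ∣ ≤ e
open Near

near? : ∀ H e v N → Dec (Near H e v N)
near? H e v N = Dec.map′ near distance≤ (∣ + 3 ℤ.* v ℤ.- N ℤ.* + H ∣ ℕ.≤? e)

near-weaken : e ≤ e′ → Near H e val N → Near H e′ val N
near-weaken e≤e′ (near d≤e) = near (ℕ.≤-trans d≤e e≤e′)

near-+ : Near H e val N → Near H e′ val′ N′ → Near H (e ℕ.+ e′) (val ℤ.+ val′) (N ℤ.+ N′)
near-+ {H} {val = val} {N} {val′ = val′} {N′} (near d≤e) (near d′≤e′) =
  near (subst (λ z → ∣ z ∣ ≤ _) (sym (split val val′ N N′ (+ H)))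
    (ℕ.≤-trans (ℤ.∣i+j∣≤∣i∣+∣j∣ (+ 3 ℤ.* val ℤ.- N ℤ.* + H) (+ 3 ℤ.* val′ ℤ.- N′ ℤ.* + H))
               (ℕ.+-mono-≤ d≤e d′≤e′)))
  where
    split : ∀ v v′ N N′ h → + 3 ℤ.* (v ℤ.+ v′) ℤ.- (N ℤ.+ N′) ℤ.* h
                          ≡ (+ 3 ℤ.* v ℤ.- N ℤ.* h) ℤ.+ (+ 3 ℤ.* v′ ℤ.- N′ ℤ.* h)
    split = ℤ-Solver.solve-∀

near-zero : Near H (3 * ∣ val ∣) val 0ℤ
near-zero {H} {val} = near (ℕ.≤-reflexive (begin
  ∣ + 3 ℤ.* val ℤ.- 0ℤ ℤ.* + H ∣ ≡⟨ cong ∣_∣ (drop val (+ H)) ⟩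
  ∣ + 3 ℤ.* val ∣                ≡⟨ ℤ.∣i*j∣≡∣i∣*∣j∣ (+ 3) val ⟩
  3 * ∣ val ∣                    ∎))
  where
    open ≡-Reasoning
    drop : ∀ v h → + 3 ℤ.* v ℤ.- 0ℤ ℤ.* h ≡ + 3 ℤ.* v
    drop = ℤ-Solver.solve-∀

near-one : Near H ∣ + 3 ℤ.* val ℤ.- + H ∣ val 1ℤ
near-one {H} {val} = near (ℕ.≤-reflexive (cong (λ z → ∣ + 3 ℤ.* val ℤ.- z ∣) (ℤ.*-identityˡ (+ H))))

near-lower : Near H e val N → ∣ N ∣ * H ≤ 3 * ∣ val ∣ ℕ.+ e
near-lower {H} {e} {val} {N} (near d≤e) = begin
  ∣ N ∣ * H                                         ≡⟨ ℤ.∣i*j∣≡∣i∣*∣j∣ N (+ H) ⟨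
  ∣ N ℤ.* + H ∣                                     ≡⟨ cong ∣_∣ (split val N (+ H)) ⟩
  ∣ + 3 ℤ.* val ℤ.- (+ 3 ℤ.* val ℤ.- N ℤ.* + H) ∣   ≤⟨ ℤ.∣i-j∣≤∣i∣+∣j∣ (+ 3 ℤ.* val) _ ⟩
  ∣ + 3 ℤ.* val ∣ ℕ.+ ∣ + 3 ℤ.* val ℤ.- N ℤ.* + H ∣ ≤⟨ ℕ.+-mono-≤ (ℕ.≤-reflexive (ℤ.∣i*j∣≡∣i∣*∣j∣ (+ 3) val)) d≤e ⟩
  3 * ∣ val ∣ ℕ.+ e                                 ∎
  where
    open ℕ.≤-Reasoning
    split : ∀ v N h → N ℤ.* h ≡ + 3 ℤ.* v ℤ.- (+ 3 ℤ.* v ℤ.- N ℤ.* h)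
    split = ℤ-Solver.solve-∀

near-upper : Near H e val N → 3 * ∣ val ∣ ≤ ∣ N ∣ * H ℕ.+ e
near-upper {H} {e} {val} {N} (near d≤e) = begin
  3 * ∣ val ∣                                     ≡⟨ ℤ.∣i*j∣≡∣i∣*∣j∣ (+ 3) val ⟨
  ∣ + 3 ℤ.* val ∣                                 ≡⟨ cong ∣_∣ (split val N (+ H)) ⟩
  ∣ N ℤ.* + H ℤ.+ (+ 3 ℤ.* val ℤ.- N ℤ.* + H) ∣   ≤⟨ ℤ.∣i+j∣≤∣i∣+∣j∣ (N ℤ.* + H) _ ⟩
  ∣ N ℤ.* + H ∣ ℕ.+ ∣ + 3 ℤ.* val ℤ.- N ℤ.* + H ∣ ≤⟨ ℕ.+-mono-≤ (ℕ.≤-reflexive (ℤ.∣i*j∣≡∣i∣*∣j∣ N (+ H))) d≤e ⟩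
  ∣ N ∣ * H ℕ.+ e                                 ∎
  where
    open ℕ.≤-Reasoning
    split : ∀ v N h → + 3 ℤ.* v ≡ N ℤ.* h ℤ.+ (+ 3 ℤ.* v ℤ.- N ℤ.* h)
    split = ℤ-Solver.solve-∀

near-unique : Near H e val N → Near H e′ val N′ → e ℕ.+ e′ < H → N ≡ N′
near-unique {H} {e} {val} {N} {e′} {N′} (near d≤e) (near d′≤e′) small =
  ℤ.i-j≡0⇒i≡j N N′ (ℤ.∣i∣≡0⇒i≡0 (ℕ.n<1⇒n≡0 (ℕ.*-cancelʳ-< H _ 1 (begin-strict
    ∣ N ℤ.- N′ ∣ * H                 ≡⟨ ℤ.∣i*j∣≡∣i∣*∣j∣ (N ℤ.- N′) (+ H) ⟨
    ∣ (N ℤ.- N′) ℤ.* + H ∣           ≡⟨ cong ∣_∣ (split val N N′ (+ H)) ⟩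
    ∣ d′ ℤ.- d ∣                     ≤⟨ ℤ.∣i-j∣≤∣i∣+∣j∣ d′ d ⟩
    ∣ d′ ∣ ℕ.+ ∣ d ∣                 ≤⟨ ℕ.+-mono-≤ d′≤e′ d≤e ⟩
    e′ ℕ.+ e                         ≡⟨ ℕ.+-comm e′ e ⟩
    e ℕ.+ e′                         <⟨ small ⟩
    H                                ≡⟨ ℕ.+-identityʳ H ⟨
    1 * H                            ∎))))
  where
    open ℕ.≤-Reasoning
    d  = + 3 ℤ.* val ℤ.- N ℤ.* + H
    d′ = + 3 ℤ.* val ℤ.- N′ ℤ.* + H
    split : ∀ v N N′ h → (N ℤ.- N′) ℤ.* h ≡ (+ 3 ℤ.* v ℤ.- N′ ℤ.* h) ℤ.- (+ 3 ℤ.* v ℤ.- N ℤ.* h)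
    split = ℤ-Solver.solve-∀

near-mono : Near H e val N → Near H e′ val′ N′ → ∣ val ∣ ≤ ∣ val′ ∣ → e ℕ.+ e′ < H → ∣ N ∣ ≤ ∣ N′ ∣
near-mono {H} {e} {val} {N} {e′} {val′} {N′} close close′ ∣val∣≤∣val′∣ small =
  ℕ.s≤s⁻¹ (ℕ.*-cancelʳ-< H _ (suc ∣ N′ ∣) (begin-strict
    ∣ N ∣ * H                    ≤⟨ near-lower close ⟩
    3 * ∣ val ∣ ℕ.+ e            ≤⟨ ℕ.+-monoˡ-≤ e (ℕ.*-monoʳ-≤ 3 ∣val∣≤∣val′∣) ⟩
    3 * ∣ val′ ∣ ℕ.+ e           ≤⟨ ℕ.+-monoˡ-≤ e (near-upper close′) ⟩
    ∣ N′ ∣ * H ℕ.+ e′ ℕ.+ e      ≡⟨ trans (ℕ.+-assoc (∣ N′ ∣ * H) e′ e) (cong (∣ N′ ∣ * H ℕ.+_) (ℕ.+-comm e′ e)) ⟩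
    ∣ N′ ∣ * H ℕ.+ (e ℕ.+ e′)    <⟨ ℕ.+-monoʳ-< (∣ N′ ∣ * H) small ⟩
    ∣ N′ ∣ * H ℕ.+ H             ≡⟨ ℕ.+-comm (∣ N′ ∣ * H) H ⟩
    suc ∣ N′ ∣ * H               ∎))
  where open ℕ.≤-Reasoning

-- Classifying by nearness rather than by equality with -H and h spares proving that the
-- three kinds of elements of X are distinct.
classify : ℕ → ℕ → ℤ → ℤ
classify H e val with near? H e val (- + 3) | near? H e val 0ℤ
... | yes _ | _     = - + 3
... | no _  | yes _ = 0ℤ
... | no _  | no _  = 1ℤ

classify≤1 : ∀ H e val → classify H e val ℤ.≤ 1ℤ
classify≤1 H e val with near? H e val (- + 3) | near? H e val 0ℤ
... | yes _ | _     = -≤+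
... | no _  | yes _ = +≤+ z≤n
... | no _  | no _  = ℤ.≤-refl

classify-near : Near H e val N → N ≡ - + 3 ⊎ N ≡ 0ℤ ⊎ N ≡ 1ℤ → Near H e val (classify H e val)
classify-near {H} {e} {val} close N∈ with near? H e val (- + 3) | near? H e val 0ℤ | N∈
... | yes close′ | _          | _                = close′
... | no _       | yes close′ | _                = close′
... | no ¬close  | no _       | inj₁ refl        = ⊥-elim (¬close close)
... | no _       | no ¬close  | inj₂ (inj₁ refl) = ⊥-elim (¬close close)
... | no _       | no _       | inj₂ (inj₂ refl) = close

0<m⊖n⇒n<m : ∀ {m n} → 0ℤ ℤ.< m ⊖ n → n < m
0<m⊖n⇒n<m {m} {n} 0<m⊖n with n ℕ.<? m
... | yes n<m = n<m
... | no  n≮m = ⊥-elim (ℤ.<⇒≱ 0<m⊖n (subst (m ⊖ n ℤ.≤_) (ℤ.n⊖n≡0 n) (ℤ.⊖-monoˡ-≤ n (ℕ.≮⇒≥ n≮m))))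

i≤0∧0<i+j⇒0<j : i ℤ.≤ 0ℤ → 0ℤ ℤ.< i ℤ.+ j → 0ℤ ℤ.< j
i≤0∧0<i+j⇒0<j {i} {j} i≤0 0<i+j =
  ℤ.<-≤-trans 0<i+j (subst (i ℤ.+ j ℤ.≤_) (ℤ.+-identityˡ j) (ℤ.+-monoˡ-≤ j i≤0))

i<0∧j≤1⇒i+j≤0 : i ℤ.< 0ℤ → j ℤ.≤ 1ℤ → i ℤ.+ j ℤ.≤ 0ℤ
i<0∧j≤1⇒i+j≤0 -<+ j≤1 = ℤ.+-mono-≤ (ℤ.-≤- z≤n) j≤1

0<i∧0<j⇒i+j≢1 : 0ℤ ℤ.< i → 0ℤ ℤ.< j → i ℤ.+ j ≢ 1ℤ
0<i∧0<j⇒i+j≢1 (+<+ {n = suc a} _) (+<+ {n = suc b} _) eq =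
  ℕ.m+1+n≢0 a (ℕ.suc-injective (ℤ.+-injective eq))

∣i+k∣<∣i+j∣ : 0ℤ ℤ.< i → 0ℤ ℤ.< j → k ℤ.< 0ℤ → 0ℤ ℤ.< k ℤ.+ (i ℤ.+ j) → ∣ i ℤ.+ k ∣ < ∣ i ℤ.+ j ∣
∣i+k∣<∣i+j∣ (+<+ {n = suc a} _) (+<+ {n = suc b} _) (-<+ {m = c}) 0<k+i+j =
  ℕ.≤-<-trans (ℤ.∣m⊝n∣≤m⊔n (suc a) (suc c))
    (ℕ.⊔-lub (ℕ.m<m+n (suc a) (s≤s z≤n)) (0<m⊖n⇒n<m {n = suc c} 0<k+i+j))

-- Minimum-cost trees whose leaves are close to multiples of H/3

module ApproximateThirds
  (H C n : ℕ) (ν : ℤ → ℤ) (ν≤1 : ∀ x → ν x ℤ.≤ 1ℤ)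
  {X : List ℤ} (X-near : All (λ x → Near H C x (ν x)) X)
  (error-small : n * C ℕ.+ n * (n * C) < H)
  {T : Tree} (T-min : IsMinCost X T) (T-value : value T ≡ 0ℤ) (T-size : size T ≡ n)
  where

  thirds : Tree → ℤ
  thirds (leaf x)   = ν x
  thirds (node l r) = thirds l ℤ.+ thirds r

  near-thirds : ∀ t → All (λ x → Near H C x (ν x)) (leaves t) → Near H (size t * C) (value t) (thirds t)
  near-thirds (leaf x)   (x-near ∷ []) = near-weaken (ℕ.≤-reflexive (sym (ℕ.+-identityʳ C))) x-near
  near-thirds (node l r) all-near      =
    near-weaken (ℕ.≤-reflexive (sym (ℕ.*-distribʳ-+ C (size l) (size r))))
      (near-+ (near-thirds l (All.++⁻ˡ (leaves l) all-near)) (near-thirds r (All.++⁻ʳ (leaves l) all-near)))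

  near-⊑ : s ⊑ T → Near H (size s * C) (value s) (thirds s)
  near-⊑ {s} P = near-thirds s (All-⊑ P (All-resp-↭ (↭-sym (proj₁ T-min)) X-near))

  depth≤n : (P : s ⊑ T) → depth P ≤ n
  depth≤n P = ℕ.≤-trans (ℕ.m≤m+n _ _) (subst (_ ≤_) T-size (depth+size≤size P))

  size≤n : s ⊑ T → size s ≤ n
  size≤n P = ℕ.≤-trans (ℕ.m≤n+m _ (depth P)) (subst (_ ≤_) T-size (depth+size≤size P))

  n≥1 : 1 ≤ n
  n≥1 = subst (1 ≤_) T-size (size≥1 T)

  double-error-small : n * C ℕ.+ n * C < H
  double-error-small =
    ℕ.≤-<-trans (ℕ.+-monoʳ-≤ (n * C) (ℕ.m≤n*m (n * C) n {{ℕ.>-nonZero n≥1}})) error-small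

  Siblings : Tree → Tree → Set
  Siblings a b = node a b ⊑ T ⊎ node b a ⊑ T

  siblings-sym : Siblings a b → Siblings b a
  siblings-sym = Sum.swap

  siblings-⊑ : Siblings a b → a ⊑ T
  siblings-⊑ (inj₁ P) = ⊑-trans (left here) P
  siblings-⊑ (inj₂ P) = ⊑-trans (right here) P

  siblings-size : Siblings a b → size a ℕ.+ size b ≤ n
  siblings-size         (inj₁ P) = size≤n P
  siblings-size {a} {b} (inj₂ P) = subst (_≤ n) (ℕ.+-comm (size b) (size a)) (size≤n P)

  regraft-bound : (P : p ⊑ T) → ∣ value p ∣ ≤ ∣ value T ∣ ℕ.+ depth P * ∣ value x ∣ →
    ∣ value p ∣ ≤ n * ∣ value x ∣
  regraft-bound {p} {x} P bound = ℕ.≤-trans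
    (subst (λ z → ∣ value p ∣ ≤ ∣ z ∣ ℕ.+ depth P * ∣ value x ∣) T-value bound)
    (ℕ.*-monoˡ-≤ ∣ value x ∣ (depth≤n P))

  siblings-regraft : Siblings a b → ∣ value a ℤ.+ value b ∣ ≤ n * ∣ value a ∣
  siblings-regraft {a} {b} (inj₁ P) =
    regraft-bound {x = a} P (minCost-regraft T-min {x = a} {s = b} P refl (++-comm (leaves b) (leaves a)) refl)
  siblings-regraft {a} {b} (inj₂ P) =
    subst (λ z → ∣ z ∣ ≤ n * ∣ value a ∣) (ℤ.+-comm (value b) (value a))
      (regraft-bound {x = a} P (minCost-regraft T-min {x = a} {s = b} P (ℤ.+-comm (value b) (value a)) ↭-refl
        (cong (∣ value b ℤ.+ value a ∣ ℕ.+_) (ℕ.+-comm (cost b) (cost a)))))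

  siblings-rotate : Siblings (node u v) w → ∣ value u ℤ.+ value v ∣ ≤ ∣ value u ℤ.+ value w ∣
  siblings-rotate (inj₁ P) = locallyMinimal-rotate (minCost⇒locallyMinimal T-min P)
  siblings-rotate (inj₂ P) = locallyMinimal-rotate (locallyMinimal-swap (minCost⇒locallyMinimal T-min P))

  near-siblings : Siblings a b → Near H (n * C) (value a ℤ.+ value b) (thirds a ℤ.+ thirds b)
  near-siblings {a} {b} S = near-weaken
    (ℕ.≤-trans (ℕ.≤-reflexive (sym (ℕ.*-distribʳ-+ C (size a) (size b)))) (ℕ.*-monoˡ-≤ C (siblings-size S)))
    (near-+ (near-⊑ (siblings-⊑ S)) (near-⊑ (siblings-⊑ (siblings-sym S))))

  zero-sibling : Siblings a b → thirds a ≡ 0ℤ → thirds a ℤ.+ thirds b ≡ 0ℤ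
  zero-sibling {a} {b} S a≈0 = near-unique (near-siblings S) near-zero (begin-strict
    n * C ℕ.+ 3 * ∣ value a ℤ.+ value b ∣ ≤⟨ ℕ.+-monoʳ-≤ (n * C) (ℕ.*-monoʳ-≤ 3 (siblings-regraft S)) ⟩
    n * C ℕ.+ 3 * (n * ∣ value a ∣)      ≡⟨ cong (n * C ℕ.+_) (ℕ*.x∙yz≈y∙xz 3 n ∣ value a ∣) ⟩
    n * C ℕ.+ n * (3 * ∣ value a ∣)      ≤⟨ ℕ.+-monoʳ-≤ (n * C) (ℕ.*-monoʳ-≤ n a-small) ⟩
    n * C ℕ.+ n * (n * C)                <⟨ error-small ⟩
    H                                    ∎)
    where
      open ℕ.≤-Reasoning
      a-small : 3 * ∣ value a ∣ ≤ n * C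
      a-small = ℕ.≤-trans
        (subst (λ z → 3 * ∣ value a ∣ ≤ ∣ z ∣ * H ℕ.+ size a * C) a≈0 (near-upper (near-⊑ (siblings-⊑ S))))
        (ℕ.*-monoˡ-≤ C (size≤n (siblings-⊑ S)))

  positive-sibling : ∀ a b → Siblings a b → 0ℤ ℤ.< thirds a ℤ.+ thirds b → 0ℤ ℤ.< thirds a
  no-negative-sibling : ∀ a b → Siblings a b → 0ℤ ℤ.< thirds a ℤ.+ thirds b → thirds a ℤ.< 0ℤ → ⊥

  positive-sibling a b S 0<ab with ℤ.<-cmp 0ℤ (thirds a)
  ... | tri< 0<a _ _ = 0<a
  ... | tri≈ _ 0≡a _ = ⊥-elim (ℤ.<-irrefl (sym (zero-sibling S (sym 0≡a))) 0<ab)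
  ... | tri> _ _ a<0 = ⊥-elim (no-negative-sibling a b S 0<ab a<0)

  no-negative-sibling a (leaf x) S 0<ab a<0 = ℤ.<⇒≱ 0<ab (i<0∧j≤1⇒i+j≤0 a<0 (ν≤1 x))
  -- Exchanging v and a gives |u + v| ≤ |u + a| for the values, but |u + a| < |u + v| for the thirds.
  no-negative-sibling a b@(node u v) S 0<ab a<0 =
    ℕ.<⇒≱ (∣i+k∣<∣i+j∣ 0<u 0<v a<0 0<ab)
      (near-mono (near-⊑ b⊑T) (near-+ (near-⊑ (⊑-trans (left here) b⊑T)) (near-⊑ (siblings-⊑ S)))
        (siblings-rotate (siblings-sym S)) small)
    where
      b⊑T : b ⊑ T
      b⊑T = siblings-⊑ (siblings-sym S)
      0<b : 0ℤ ℤ.< thirds b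
      0<b = i≤0∧0<i+j⇒0<j (ℤ.<⇒≤ a<0) 0<ab
      0<u : 0ℤ ℤ.< thirds u
      0<u = positive-sibling u v (inj₁ b⊑T) 0<b
      0<v : 0ℤ ℤ.< thirds v
      0<v = positive-sibling v u (inj₂ b⊑T) (subst (0ℤ ℤ.<_) (ℤ.+-comm (thirds u) (thirds v)) 0<b)
      open ℕ.≤-Reasoning
      small : size b * C ℕ.+ (size u * C ℕ.+ size a * C) < H
      small = begin-strict
        size b * C ℕ.+ (size u * C ℕ.+ size a * C) ≡⟨ cong (size b * C ℕ.+_) (ℕ.*-distribʳ-+ C (size u) (size a)) ⟨
        size b * C ℕ.+ (size u ℕ.+ size a) * C     ≤⟨ ℕ.+-mono-≤ (ℕ.*-monoˡ-≤ C (size≤n b⊑T)) (ℕ.*-monoˡ-≤ C u+a≤n) ⟩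
        n * C ℕ.+ n * C                            <⟨ double-error-small ⟩
        H                                          ∎
        where
          u+a≤n : size u ℕ.+ size a ≤ n
          u+a≤n = ℕ.≤-trans (ℕ.+-monoˡ-≤ (size a) (ℕ.m≤m+n (size u) (size v)))
                    (subst (_≤ n) (ℕ.+-comm (size a) (size b)) (siblings-size S))

  thirds≡1⇒leaf : ∀ t → t ⊑ T → thirds t ≡ 1ℤ → IsLeaf t
  thirds≡1⇒leaf (leaf x)   _ _   = x , refl
  thirds≡1⇒leaf (node l r) P l+r≡1 =
    ⊥-elim (0<i∧0<j⇒i+j≢1 (positive-sibling l r (inj₁ P) 0<l+r) (positive-sibling r l (inj₂ P) 0<r+l) l+r≡1)
    where
      0<l+r : 0ℤ ℤ.< thirds l ℤ.+ thirds r
      0<l+r = subst (0ℤ ℤ.<_) (sym l+r≡1) (+<+ (s≤s z≤n))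
      0<r+l : 0ℤ ℤ.< thirds r ℤ.+ thirds l
      0<r+l = subst (0ℤ ℤ.<_) (ℤ.+-comm (thirds l) (thirds r)) 0<l+r

  near-one⇒thirds≡1 : t ⊑ T → Near H e (value t) 1ℤ → 2 * e ≤ H → thirds t ≡ 1ℤ
  near-one⇒thirds≡1 {t} {e} P close 2e≤H = near-unique (near-⊑ P) close
    (ℕ.≤-<-trans (ℕ.+-monoˡ-≤ e (ℕ.*-monoˡ-≤ C (size≤n P))) (ℕ.*-cancelˡ-< 2 _ _ (begin-strict
      2 * (n * C ℕ.+ e)       ≡⟨ double (n * C) e ⟩
      n * C ℕ.+ n * C ℕ.+ 2 * e <⟨ ℕ.+-mono-<-≤ double-error-small 2e≤H ⟩
      H ℕ.+ H                 ≡⟨ cong (H ℕ.+_) (ℕ.+-identityʳ H) ⟨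
      2 * H                   ∎)))
    where
      open ℕ.≤-Reasoning
      double : ∀ a b → 2 * (a ℕ.+ b) ≡ a ℕ.+ a ℕ.+ 2 * b
      double = ℕ-Solver.solve-∀

module Construction (k K : ℕ) (K≥1 : 1 ≤ K) (b : Fin (3 * suc k) → ℕ) where

  m C n q : ℕ
  m = suc k
  C = 3 * (K ℕ.+ hh m K)
  n = 3 * m ℕ.+ (m ℕ.+ m)
  q = m * m * K

  ν : ℤ → ℤ
  ν = classify (HH m K) C

  shift-W : ℕ → ℤ
  shift-W c = + (c ℕ.+ W m K)

  h≤4K : hh m K ≤ 4 * K
  h≤4K = begin
    4 * L m K / D     ≤⟨ /-monoˡ-≤ D 4L≤4KD ⟩
    4 * K * D / D     ≡⟨ m*n/n≡m (4 * K) D ⟩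
    4 * K             ∎
    where
      open ℕ.≤-Reasoning
      D A : ℕ
      D = 400 * (5 * m) ^ 2
      A = (5 * m) ^ 2 * K
      expand : ∀ s K → 4 * (3 * (100 * s * K) ℕ.+ K) ≡ 1200 * (s * K) ℕ.+ 4 * K
      expand = ℕ-Solver.solve-∀
      collect : ∀ s K → 1200 * (s * K) ℕ.+ 400 * (s * K) ≡ 4 * K * (400 * s)
      collect = ℕ-Solver.solve-∀
      4L≤4KD : 4 * L m K ≤ 4 * K * D
      4L≤4KD = begin
        4 * L m K                  ≡⟨ expand ((5 * m) ^ 2) K ⟩
        1200 * A ℕ.+ 4 * K         ≤⟨ ℕ.+-monoʳ-≤ (1200 * A) (ℕ.*-monoʳ-≤ 4 (ℕ.m≤n*m K ((5 * m) ^ 2))) ⟩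
        1200 * A ℕ.+ 4 * A         ≤⟨ ℕ.+-monoʳ-≤ (1200 * A) (ℕ.*-monoˡ-≤ A (ℕ.m≤m+n 4 396)) ⟩
        1200 * A ℕ.+ 400 * A       ≡⟨ collect ((5 * m) ^ 2) K ⟩
        4 * K * D                  ∎

  H≥7500q : 7500 * q ≤ HH m K
  H≥7500q = begin
    7500 * q                          ≡⟨ three-W m K ⟨
    3 * W m K                         ≤⟨ ℕ.m≤m+n (3 * W m K) K ⟩
    L m K                             ≤⟨ ℕ.m≤m+n (L m K) (hh m K) ⟩
    HH m K                            ∎
    where
      open ℕ.≤-Reasoning
      three-W : ∀ m K → 3 * (100 * (5 * m * (5 * m * 1)) * K) ≡ 7500 * (m * m * K)
      three-W = ℕ-Solver.solve-∀

  error-small : n * C ℕ.+ n * (n * C) < HH m K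
  error-small = begin-strict
    n * C ℕ.+ n * (n * C)             ≤⟨ ℕ.+-mono-≤ nC≤ (ℕ.*-monoʳ-≤ n nC≤) ⟩
    75 * (m * K) ℕ.+ n * (75 * (m * K)) ≡⟨ cong (75 * (m * K) ℕ.+_) (five-m m K) ⟩
    75 * (m * K) ℕ.+ 375 * q          ≤⟨ ℕ.+-monoˡ-≤ (375 * q) (ℕ.*-monoʳ-≤ 75 (ℕ.*-monoˡ-≤ K (ℕ.m≤m*n m m))) ⟩
    75 * q ℕ.+ 375 * q                ≡⟨ ℕ.*-distribʳ-+ q 75 375 ⟨
    450 * q                           <⟨ ℕ.*-monoˡ-< q {{ℕ.>-nonZero q≥1}} (ℕ.m<m+n 450 {7050} (s≤s z≤n)) ⟩
    7500 * q                          ≤⟨ H≥7500q ⟩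
    HH m K                            ∎
    where
      open ℕ.≤-Reasoning
      q≥1 : 1 ≤ q
      q≥1 = ℕ.*-mono-≤ {1} {m * m} (s≤s z≤n) K≥1
      bound : ∀ m K → (3 * m ℕ.+ (m ℕ.+ m)) * (3 * (K ℕ.+ 4 * K)) ≡ 75 * (m * K)
      bound = ℕ-Solver.solve-∀
      five-m : ∀ m K → (3 * m ℕ.+ (m ℕ.+ m)) * (75 * (m * K)) ≡ 375 * (m * m * K)
      five-m = ℕ-Solver.solve-∀
      nC≤ : n * C ≤ 75 * (m * K)
      nC≤ = ℕ.≤-trans (ℕ.*-monoʳ-≤ n (ℕ.*-monoʳ-≤ 3 (ℕ.+-monoʳ-≤ K h≤4K))) (ℕ.≤-reflexive (bound m K))

  a-shift : ∀ c → + 3 ℤ.* shift-W c ℤ.- 1ℤ ℤ.* + HH m K ≡ 3 * c ⊖ (K ℕ.+ hh m K)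
  a-shift c = begin
    + 3 ℤ.* shift-W c ℤ.- 1ℤ ℤ.* + HH m K
      ≡⟨ cong₂ (λ x y → + 3 ℤ.* x ℤ.- 1ℤ ℤ.* y) (ℤ.pos-+ c (W m K))
           (trans (ℤ.pos-+ (L m K) (hh m K)) (cong (λ z → z ℤ.+ + hh m K)
             (trans (ℤ.pos-+ (3 * W m K) K) (cong (λ z → z ℤ.+ + K) (ℤ.pos-* 3 (W m K)))))) ⟩
    + 3 ℤ.* (+ c ℤ.+ + W m K) ℤ.- 1ℤ ℤ.* (+ 3 ℤ.* + W m K ℤ.+ + K ℤ.+ + hh m K)
      ≡⟨ cancel (+ c) (+ W m K) (+ K) (+ hh m K) ⟩
    + 3 ℤ.* + c ℤ.- (+ K ℤ.+ + hh m K)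
      ≡⟨ cong₂ ℤ._-_ (ℤ.pos-* 3 c) (ℤ.pos-+ K (hh m K)) ⟨
    + (3 * c) ℤ.- + (K ℕ.+ hh m K)
      ≡⟨ ℤ.[+m]-[+n]≡m⊖n (3 * c) (K ℕ.+ hh m K) ⟩
    3 * c ⊖ (K ℕ.+ hh m K) ∎
    where
      open ≡-Reasoning
      cancel : ∀ c w k h → + 3 ℤ.* (c ℤ.+ w) ℤ.- 1ℤ ℤ.* (+ 3 ℤ.* w ℤ.+ k ℤ.+ h) ≡ + 3 ℤ.* c ℤ.- (k ℤ.+ h)
      cancel = ℤ-Solver.solve-∀

  near-a : ∀ c → c ≤ K → Near (HH m K) C (shift-W c) 1ℤ
  near-a c c≤K = near (begin
    ∣ + 3 ℤ.* shift-W c ℤ.- 1ℤ ℤ.* + HH m K ∣ ≡⟨ cong ∣_∣ (a-shift c) ⟩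
    ∣ 3 * c ⊖ (K ℕ.+ hh m K) ∣                     ≤⟨ ℤ.∣m⊝n∣≤m⊔n (3 * c) (K ℕ.+ hh m K) ⟩
    3 * c ℕ.⊔ (K ℕ.+ hh m K)                       ≤⟨ ℕ.⊔-lub (ℕ.*-monoʳ-≤ 3 (ℕ.≤-trans c≤K (ℕ.m≤m+n K _)))
                                                                 (ℕ.m≤n*m (K ℕ.+ hh m K) 3) ⟩
    C                                              ∎)
    where open ℕ.≤-Reasoning

  near-−H : Near (HH m K) C (- + HH m K) (- + 3)
  near-−H = near (subst (λ z → ∣ z ∣ ≤ C) (sym (cancel (+ HH m K))) z≤n)
    where
      cancel : ∀ x → + 3 ℤ.* - x ℤ.- - + 3 ℤ.* x ≡ 0ℤ
      cancel = ℤ-Solver.solve-∀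

  near-h : Near (HH m K) C (+ hh m K) 0ℤ
  near-h = near-weaken (ℕ.*-monoʳ-≤ 3 (ℕ.m≤n+m (hh m K) K)) near-zero

  X-near : (∀ i → 2 * b i < K) → All (λ x → Near (HH m K) C x (ν x)) (X m K b)
  X-near 2b<K =
    All.++⁺ (All.map⁺ {f = shift-W} (All.tabulate⁺ {f = b} λ i →
               classify-near (near-a (b i) (b≤K i)) (inj₂ (inj₂ refl))))
    (All.++⁺ (All.replicate⁺ m (classify-near near-−H (inj₁ refl)))
             (All.replicate⁺ m (classify-near near-h (inj₂ (inj₁ refl)))))
    where
      b≤K : ∀ i → b i ≤ K
      b≤K i = ℕ.≤-trans (ℕ.m≤m+n (b i) (b i ℕ.+ 0)) (ℕ.<⇒≤ (2b<K i))

  X-length : length (X m K b) ≡ n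
  X-length = trans (List.length-++ (map shift-W (toList b)))
    (cong₂ ℕ._+_ (trans (List.length-map shift-W (toList b)) (List.length-tabulate b))
      (trans (List.length-++ (replicate m (- + HH m K)))
        (cong₂ ℕ._+_ (List.length-replicate m) (List.length-replicate m))))

  X-total : sum (toList b) ≡ m * K → total (X m K b) ≡ 0ℤ
  X-total Σb = begin
    total (X m K b)
      ≡⟨ trans (total-++ (map shift-W (toList b)) _)
           (cong (λ z → total (map shift-W (toList b)) ℤ.+ z) (total-++ (replicate m (- + HH m K)) _)) ⟩
    total (map shift-W (toList b)) ℤ.+ (total (replicate m (- + HH m K)) ℤ.+ total (replicate m (+ hh m K)))
      ≡⟨ cong₂ (λ x y → x ℤ.+ y) (total-shift (W m K) (toList b))
           (cong₂ ℤ._+_ (total-replicate m (- + HH m K)) (total-replicate m (+ hh m K))) ⟩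
    + (sum (toList b) ℕ.+ length (toList b) * W m K) ℤ.+ (+ m ℤ.* - + HH m K ℤ.+ + m ℤ.* + hh m K)
      ≡⟨ cong (λ x → + x ℤ.+ (+ m ℤ.* - + HH m K ℤ.+ + m ℤ.* + hh m K))
           (cong₂ ℕ._+_ Σb (cong (_* W m K) (List.length-tabulate b))) ⟩
    + (m * K ℕ.+ 3 * m * W m K) ℤ.+ (+ m ℤ.* - + HH m K ℤ.+ + m ℤ.* + hh m K)
      ≡⟨ cong₂ (λ x y → x ℤ.+ (+ m ℤ.* - y ℤ.+ + m ℤ.* + hh m K)) positive H-split ⟩
    + m ℤ.* + K ℤ.+ + 3 ℤ.* + m ℤ.* + W m K
      ℤ.+ (+ m ℤ.* - (+ 3 ℤ.* + W m K ℤ.+ + K ℤ.+ + hh m K) ℤ.+ + m ℤ.* + hh m K)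
      ≡⟨ cancel (+ m) (+ K) (+ W m K) (+ hh m K) ⟩
    0ℤ ∎
    where
      open ≡-Reasoning
      positive : + (m * K ℕ.+ 3 * m * W m K) ≡ + m ℤ.* + K ℤ.+ + 3 ℤ.* + m ℤ.* + W m K
      positive = trans (ℤ.pos-+ (m * K) _)
        (cong₂ ℤ._+_ (ℤ.pos-* m K) (trans (ℤ.pos-* (3 * m) (W m K)) (cong (ℤ._* + W m K) (ℤ.pos-* 3 m))))
      H-split : + HH m K ≡ + 3 ℤ.* + W m K ℤ.+ + K ℤ.+ + hh m K
      H-split = trans (ℤ.pos-+ (L m K) (hh m K)) (cong (λ z → z ℤ.+ + hh m K)
        (trans (ℤ.pos-+ (3 * W m K) K) (cong (λ z → z ℤ.+ + K) (ℤ.pos-* 3 (W m K)))))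
      cancel : ∀ m K w h → m ℤ.* K ℤ.+ + 3 ℤ.* m ℤ.* w ℤ.+ (m ℤ.* - (+ 3 ℤ.* w ℤ.+ K ℤ.+ h) ℤ.+ m ℤ.* h) ≡ 0ℤ
      cancel = ℤ-Solver.solve-∀

  third-error : ∀ v → OfFormThird m K v → 2 * ∣ + 3 ℤ.* v ℤ.- + HH m K ∣ ≤ HH m K
  third-error v third = ℕ.*-cancelˡ-≤ 3 (begin
    3 * (2 * d)   ≡⟨ ℕ.*-assoc 3 2 d ⟨
    6 * d         ≤⟨ ℕ.*-monoˡ-≤ d (ℕ.≤-trans (ℕ.m≤m+n 6 494) (ℕ.m≤m*n 500 m)) ⟩
    500 * m * d   ≤⟨ third ⟩
    3 * HH m K    ∎)
    where
      open ℕ.≤-Reasoning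
      d : ℕ
      d = ∣ + 3 ℤ.* v ℤ.- + HH m K ∣

lemma2p8 : (m K : ℕ) → 1 ≤ m → 1 ≤ K →
    (b : Fin (3 * m) → ℕ) →
    (∀ i → 1 ≤ b i) →
    (∀ i → K < 4 * b i) →
    (∀ i → 2 * b i < K) →
    sum (toList b) ≡ m * K →
    (T : Tree) → IsMinCost (X m K b) T →
    (z : Tree) → z ⊑ T → OfFormThird m K (value z) →
    IsLeaf z
lemma2p8 (suc k) K _ K≥1 b _ _ 2b<K Σb≡mK T T-min z z⊑T z-third =
  thirds≡1⇒leaf z z⊑T (near-one⇒thirds≡1 z⊑T near-one (third-error (value z) z-third))
  where
    open Construction k K K≥1 b
    open ApproximateThirds (HH m K) C n ν (classify≤1 (HH m K) C) (X-near 2b<K) error-small {T} T-min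
      (trans (value-over {T} (proj₁ T-min)) (X-total Σb≡mK))
      (trans (size-over {T} (proj₁ T-min)) X-length)
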